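{- Let $D_S=(N_S,A_S\cup H_S)$ be a partially time-expanded network (with respect to $D$ and $T$) satisfying properties (P1)–(P4), let $\bar{x}$ be a feasible solution of $\mathrm{UPR}(D_T)$, and let $\hat{x}=\mu(\bar{x})$. Let $v\in N$. Then every packet $k\in\mathcal{K}^1_{\hat{x}}(v)$ that is not stored at $v$ (at any time) in $\bar{x}$ is not stored at $v$ (at any time) in $\hat{x}$.
   Context: Base network: a directed graph $D=(N,A)$; each arc $vw\in A$ has a transit time $\tau_{vw}\in\mathbb{N}$ and a capacity $u_{vw}\in\mathbb{N}$; each node $v\in N$ has a storage capacity $b_v\in\mathbb{N}$. $\mathcal{K}$ is a finite set of packets; packet $k$ has origin $s_k$ and destination $t_k$. For $v\in N$ let $\mathcal{K}_v=\{k\in\mathcal{K}: s_k\ne v,\ t_k\ne v\}$ (packets active at $v$). Fix $T\in\mathbb{N}$ and write $[T]=\{0,1,\dots,T\}$. Fully time-expanded network $D_T=(N_T,A_T\cup H_T)$: $N_T=\{(v,t):v\in N,t\in[T]\}$; movement arcs $A_T=\{((v,t),(w,t+\tau_{vw})): (v,t)\in N_T, vw\in A, t+\tau_{vw}\le T\}$; holdover arcs $H_T=\{((v,t),(v,t+1)): v\in N, t\in\{0,\dots,T-1\}\}$. A trajectory is a directed path in a time-expanded network. A packet is stored at a timed node $(v,t)$ if its trajectory uses the holdover arc leaving $(v,t)$. $\mathrm{UPR}(D_T)$ is the integer program with binary variables $x^k_e$ ($k\in\mathcal{K}$, $e\in A_T\cup H_T$) and a variable $\bar T$: minimize $\bar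 T$ subject to $t'x^k_e\le\bar T$ for all $k$ and all $e=((v,t),(w,t'))\in A_T$; $\sum_{e=((v,t),(w,t'))\in A_T,\, w=t_k} t'x^k_e\le \bar T$ for all $k$; flow conservation (out-flow minus in-flow of packet $k$ at $(v,t)\in N_T$ equals $1$ if $(v,t)=(s_k,0)$, $-1$ if $(v,t)=(t_k,T)$, and $0$ otherwise); $\sum_{k\in\mathcal{K}}x^k_e\le u_{vw}$ for every $e\in A_T$ that is a copy of $vw$; $\sum_{k\in\mathcal{K}_v}x^k_e\le b_v$ for every holdover arc $e$ at $v$. Thus a feasible solution assigns to each packet $k$ a trajectory $Q_k$ in $D_T$ from $(s_k,0)$ to $(t_k,T)$. Partially time-expanded network: $N_S\subseteq N_T$; for $v\in N$ and any $t$, $\mathtt{n_S}(v,t)=\min\{t'>t:(v,t')\in N_S\}$ and $\mathtt{m_S}(v,t)=\mathtt{n_S}(v,t)-t$; $H_S$ consists of the arcs $((v,t),(v,\mathtt{n_S}(v,t)))$ for $(v,t)\in N_S$ with $t<T$; $A_S$ is a set of arcs $((v,t),(w,t'))$ with $(v,t),(w,t')\in N_S$, $vw\in A$. Properties: (P1) $(s_k,0),(t_k,T)\in N_S$ for all $k$; (P2) every $((v,t),(w,t'))\in A_S$ has $t'\le t+\tau_{vw}$; (P3) for every $vw\in A$ and $(v,t)\in N_S$ with $t+\tau_{vw}\le T$ there is a copy of $vw$ in $A_S$ starting at $(v,t)$; (P4) if $((v,t),(w,t'))\in A_S$ then there is no $(w,t'')\in N_S$ with $t'<t''\le t+\tau_{vw}$.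 Map $\mu:A_T\to A_S$: $((v,\bar t),(w,\bar t'))\mapsto((v,\hat t),(w,\hat t'))$ where $\hat t=\max\{t\le\bar t:(v,t)\in N_S\}$ and $\hat t'=\max\{t\le \hat t+\tau_{vw}:(w,t)\in N_S\}$. For a feasible $\bar x$ of $\mathrm{UPR}(D_T)$, $\hat x=\mu(\bar x)$ is the binary vector such that, for each packet $k$, $\hat x^k$ is the incidence vector of the trajectory in $D_S$ whose movement arcs are the images under $\mu$ of the movement arcs of $Q_k$ (in order), joined by holdover arcs of $H_S$; on movement arcs, $\hat x^k_e=\max\{\bar x^k_f:\mu(f)=e\}$. For a packet $k$ whose path in $D$ visits $v$ immediately after a node $u$, the movement arc of $Q_k$ from $u$ to $v$ is $((u,\bar t^{k,out}_u),(v,\bar t^{k,in}_v))$, and its image under $\mu$ is $((u,\hat t^{k,out}_u),(v,\hat t^{k,in}_v))$ (so $\hat t^{k,out}_u\le\bar t^{k,out}_u$). Let $\mathcal{K}(v)$ be the set of packets in $\mathcal{K}_v$ whose trajectory in $\bar x$ contains a timed copy of $v$. $\mathcal{K}^1_{\hat x}(v)$ is the set of packets $k\in\mathcal{K}(v)$ with $\hat t^{k,out}_u=\bar t^{k,out}_u$ (same departure time from the node preceding $v$ in $\hat x$ and $\bar x$), and $\mathcal{K}^2_{\hat x}(v)$ is the set of $k\in\mathcal{K}(v)$ with $\hat t^{k,out}_u<\bar t^{k,out}_u$. -}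

module Defs where

open import Data.Nat using (ℕ; zero; suc; _+_; _∸_; _≤_; _<_)
import Data.Nat as ℕ
open import Data.Fin using (Fin)
import Data.Fin as Fin
open import Data.Bool using (Bool; true; false; if_then_else_; _∧_; not)
open import Data.List using (List; []; _∷_; _++_; map; allFin; upTo; filterᵇ)
open import Data.Nat.ListAction using (sum)
open import Data.List.Membership.Propositional using (_∈_)
open import Data.List.Relation.Unary.Any using (Any)
open import Data.Product using (_×_; _,_; ∃; proj₁; proj₂)
open import Relation.Binary.PropositionalEquality using (_≡_)
open import Relation.Nullary using (¬_)
open import Relation.Nullary.Decidable using (⌊_⌋)

-- Base network D = (N, A) with nodes Fin n and arcs Fin m,
-- transit times τ, arc capacities u, storage capacities b,
-- and a finite set of packets Fin p with origins and destinations.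

record Instance : Set where
  field
    n m p   : ℕ
    src tgt : Fin m → Fin n
    simple  : ∀ a a' → src a ≡ src a' → tgt a ≡ tgt a' → a ≡ a'   -- A ⊆ N × N
    τ u     : Fin m → ℕ
    b       : Fin n → ℕ
    orig dest : Fin p → Fin n

module _ (I : Instance) (T : ℕ) where
  open Instance I

  TNode : Set
  TNode = Fin n × ℕ

  data Step : TNode → TNode → Set where
    move : (a : Fin m) (t : ℕ) → t + τ a ≤ T → Step (src a , t) (tgt a , t + τ a)
    hold : (v : Fin n) (t : ℕ) → t < T → Step (v , t) (v , suc t)

  data Traj : TNode → TNode → Set where
    []  : ∀ {x} → Traj x x
    _∷_ : ∀ {x y z} → Step x y → Traj y z → Traj x z

  -- value of x^k_e on the movement arc (a at time t) / holdover arc at (v,t)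
  moveCount : ∀ {x y} → Traj x y → Fin m → ℕ → ℕ
  moveCount [] a t = 0
  moveCount (move a' t' _ ∷ Q) a t =
    (if ⌊ a' Fin.≟ a ⌋ ∧ ⌊ t' ℕ.≟ t ⌋ then 1 else 0) + moveCount Q a t
  moveCount (hold _ _ _ ∷ Q) a t = moveCount Q a t

  holdCount : ∀ {x y} → Traj x y → Fin n → ℕ → ℕ
  holdCount [] v t = 0
  holdCount (move _ _ _ ∷ Q) v t = holdCount Q v t
  holdCount (hold v' t' _ ∷ Q) v t =
    (if ⌊ v' Fin.≟ v ⌋ ∧ ⌊ t' ℕ.≟ t ⌋ then 1 else 0) + holdCount Q v t

  sumK : (Fin p → ℕ) → ℕ
  sumK f = sum (map f (allFin p))

  activeᵇ : Fin n → Fin p → Bool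
  activeᵇ v k = not ⌊ orig k Fin.≟ v ⌋ ∧ not ⌊ dest k Fin.≟ v ⌋

  Active : Fin n → Fin p → Set
  Active v k = ¬ (orig k ≡ v) × ¬ (dest k ≡ v)

  record Feasible : Set where
    field
      Q          : (k : Fin p) → Traj (orig k , 0) (dest k , T)
      binaryMove : ∀ k a t → moveCount (Q k) a t ≤ 1
      binaryHold : ∀ k v t → holdCount (Q k) v t ≤ 1
      capacity   : ∀ a t → sumK (λ k → moveCount (Q k) a t) ≤ u a
      storage    : ∀ v t →
                   sumK (λ k → if activeᵇ v k then holdCount (Q k) v t else 0) ≤ b v

  -- N_S is given by the Boolean membership test inS; A_S by the relation AS
  -- (AS a t t' : the arc ((src a,t),(tgt a,t')) belongs to A_S).
  record PartialTEN : Set₁ where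
    field
      inS      : Fin n → ℕ → Bool
      inS⊆NT   : ∀ v t → inS v t ≡ true → t ≤ T
      AS       : Fin m → ℕ → ℕ → Set
      AS-nodes : ∀ a t t' → AS a t t' → inS (src a) t ≡ true × inS (tgt a) t' ≡ true
      P1       : ∀ k → inS (orig k) 0 ≡ true × inS (dest k) T ≡ true
      P2       : ∀ a t t' → AS a t t' → t' ≤ t + τ a
      P3       : ∀ a t → inS (src a) t ≡ true → t + τ a ≤ T → ∃ λ t' → AS a t t'
      P4       : ∀ a t t' → AS a t t' →
                 ∀ t'' → t' < t'' → t'' ≤ t + τ a → inS (tgt a) t'' ≡ false

  -- arcs of D_S: movement arcs ((src a,t),(tgt a,t')) and holdover arcs
  -- ((v,t),(v,n_S(v,t))) (identified by their tail (v,t))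
  data SArc : Set where
    moveS : Fin m → ℕ → ℕ → SArc
    holdS : Fin n → ℕ → SArc

  module _ (S : PartialTEN) where
    open PartialTEN S

    -- prevS v t = max { t' ≤ t : (v,t') ∈ N_S }   (0 if the set is empty;
    -- this junk value never arises along trajectories)
    prevS : Fin n → ℕ → ℕ
    prevS v zero    = zero
    prevS v (suc t) = if inS v (suc t) then suc t else prevS v t

    μ : Fin m × ℕ → Fin m × ℕ × ℕ
    μ (a , t) = a , prevS (src a) t , prevS (tgt a) (prevS (src a) t + τ a)

    holds : Fin n → ℕ → ℕ → List SArc
    holds v t₁ t₂ = map (holdS v) (filterᵇ (inS v) (map (t₁ +_) (upTo (t₂ ∸ t₁))))

    joinS : Fin n → ℕ → List (Fin m × ℕ × ℕ) → List SArc
    joinS v t [] = holds v t T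
    joinS v t ((a , d , r) ∷ rest) = holds v t d ++ (moveS a d r ∷ joinS (tgt a) r rest)

  moves : ∀ {x y} → Traj x y → List (Fin m × ℕ)
  moves [] = []
  moves (move a t _ ∷ Q) = (a , t) ∷ moves Q
  moves (hold _ _ _ ∷ Q) = moves Q

  nodes : ∀ {x y} → Traj x y → List TNode
  nodes {x} [] = x ∷ []
  nodes {x} (_ ∷ Q) = x ∷ nodes Q

  module _ (x̄ : Feasible) where
    open Feasible x̄

    -- the trajectory of packet k in x̂ = μ(x̄), as a list of arcs of D_S
    trajHat : PartialTEN → Fin p → List (SArc)
    trajHat S k = joinS S (orig k) 0 (map (μ S) (moves (Q k)))

    InK : Fin n → Fin p → Set
    InK v k = Active v k × Any (λ y → proj₁ y ≡ v) (nodes (Q k))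

    -- 𝒦¹_x̂(v): for every movement arc of Q_k entering v (from u),
    -- the departure time from u is the same in x̂ and in x̄
    InK¹ : PartialTEN → Fin n → Fin p → Set
    InK¹ S v k = InK v k ×
      (∀ a t → (a , t) ∈ moves (Q k) → tgt a ≡ v → prevS S (src a) t ≡ t)

    StoredBar : Fin p → Fin n → Set
    StoredBar k v = ∃ λ t → 1 ≤ holdCount (Q k) v t

    StoredHat : PartialTEN → Fin p → Fin n → Set
    StoredHat S k v = ∃ λ t → holdS v t ∈ trajHat S k

{-# OPTIONS --safe #-}
module Submission where

-- Follow the trajectory of k in x̄ together with its image in D_S. Whenever the
-- packet sits at v at time s in x̄, its image sits at (v, prevS v s): on arrival
-- this holds because k ∈ 𝒦¹ leaves the preceding node at a time of N_S, so μ
-- reproduces the departure exactly.  As k is not stored at v in x̄, it leaves v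
-- again at the same time s, whose image departs from prevS v s; so the image
-- waits zero steps at v and uses no holdover arc of H_S there.

open import Defs
import Data.Nat
open import Data.Nat using (ℕ; suc; _+_; _≤_; _<_; s≤s; z≤n)
open import Data.Nat.Properties using (n∸n≡0; ≤-refl; ≤-trans; m≤n+m)
open import Data.Fin using (Fin; _≟_)
open import Data.List using ([]; _∷_; map)
open import Data.List.Membership.Propositional using (_∈_; _∉_)
open import Data.List.Membership.Propositional.Properties using (∈-map⁻; ∈-++⁻)
open import Data.List.Relation.Unary.Any using (here; there)
open import Data.Product using (_,_; ∃)
open import Data.Sum using (inj₁; inj₂)
open import Data.Empty using (⊥-elim)
open import Relation.Binary.PropositionalEquality using (_≡_; _≢_; refl)
open import Relation.Nullary using (¬_; yes; no)

module _ {I : Instance} {T : ℕ} where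
  open Instance I

  StoredIn : ∀ {x y} → Traj I T x y → Fin n → Set
  StoredIn Q v = ∃ λ t → 1 ≤ holdCount I T Q v t

  holdCount-∷ : ∀ {x y z} (e : Step I T x y) (Q : Traj I T y z) v t →
                holdCount I T Q v t ≤ holdCount I T (e ∷ Q) v t
  holdCount-∷ (move _ _ _) Q v t = ≤-refl
  holdCount-∷ (hold _ _ _) Q v t = m≤n+m _ _

  storedIn-∷ : ∀ {x y z} (e : Step I T x y) (Q : Traj I T y z) {v} →
               StoredIn Q v → StoredIn (e ∷ Q) v
  storedIn-∷ e Q {v} (t , 1≤) = t , ≤-trans 1≤ (holdCount-∷ e Q v t)

  storedIn-hold : ∀ w s (s<T : s < T) {z} (Q : Traj I T (w , suc s) z) →
                  StoredIn (hold w s s<T ∷ Q) w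
  storedIn-hold w s s<T Q = s , holdCount-self
    where
      holdCount-self : 1 ≤ holdCount I T (hold w s s<T ∷ Q) w s
      holdCount-self with w ≟ w | s Data.Nat.≟ s
      ... | yes _  | yes _  = s≤s z≤n
      ... | no w≢w | _      = ⊥-elim (w≢w refl)
      ... | yes _  | no s≢s = ⊥-elim (s≢s refl)

module _ {I : Instance} {T : ℕ} (S : PartialTEN I T) where
  open Instance I

  holdS-∉-holds : ∀ {v t} w r d → w ≢ v → holdS v t ∉ holds I T S w r d
  holdS-∉-holds w r d w≢v mem with ∈-map⁻ (holdS w) mem
  ... | _ , _ , refl = w≢v refl

  holds-empty : ∀ w r → holds I T S w r r ≡ []
  holds-empty w r rewrite n∸n≡0 r = refl

  holdS-∉-holds-prevS : ∀ {v t} w r s → (w ≡ v → prevS I T S w s ≡ r) →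
                        holdS v t ∉ holds I T S w r (prevS I T S w s)
  holdS-∉-holds-prevS {v} w r s synced mem with w ≟ v
  ... | no w≢v = holdS-∉-holds w r (prevS I T S w s) w≢v mem
  ... | yes refl rewrite synced refl | holds-empty w r with mem
  ...   | ()

  -- The invariant: the image trajectory is at node w at time r, and if w = v
  -- then r = prevS v s, where s is the current time in x̄.
  holdS-∉-joinS :
    ∀ {v t w s z} (Q : Traj I T (w , s) (z , T)) (r : ℕ) →
    z ≢ v →
    (w ≡ v → prevS I T S w s ≡ r) →
    ¬ StoredIn Q v →
    (∀ a t' → (a , t') ∈ moves I T Q → tgt a ≡ v → prevS I T S (src a) t' ≡ t') →
    holdS v t ∉ joinS I T S w r (map (μ I T S) (moves I T Q))
  holdS-∉-joinS {z = z} [] r z≢v _ _ _ = holdS-∉-holds z r T z≢v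
  holdS-∉-joinS {v} (hold w s s<T ∷ Q) r z≢v _ unstored sameDep =
    holdS-∉-joinS Q r z≢v (λ w≡v → ⊥-elim (w≢v w≡v))
      (λ st → unstored (storedIn-∷ (hold w s s<T) Q st)) sameDep
    where
      w≢v : w ≢ v
      w≢v refl = unstored (storedIn-hold w s s<T Q)
  holdS-∉-joinS {v} (move a s s+τ≤T ∷ Q) r z≢v synced unstored sameDep mem
    with ∈-++⁻ (holds I T S (src a) r (prevS I T S (src a) s)) mem
  ... | inj₁ mem′ = holdS-∉-holds-prevS (src a) r s synced mem′
  ... | inj₂ (there mem′) =
    holdS-∉-joinS Q _ z≢v arrivalSynced
      (λ st → unstored (storedIn-∷ (move a s s+τ≤T) Q st))
      (λ a′ t′ m → sameDep a′ t′ (there m)) mem′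
    where
      arrivalSynced : tgt a ≡ v → prevS I T S (tgt a) (s + τ a)
                                ≡ prevS I T S (tgt a) (prevS I T S (src a) s + τ a)
      arrivalSynced tgt≡v rewrite sameDep a s (here refl) tgt≡v = refl

lemma3 : (I : Instance) (T : ℕ) (S : PartialTEN I T) (x̄ : Feasible I T)
         (v : Fin (Instance.n I)) (k : Fin (Instance.p I)) →
         InK¹ I T x̄ S v k →
         ¬ StoredBar I T x̄ k v →
         ¬ StoredHat I T x̄ S k v
lemma3 I T S x̄ v k (((orig≢v , dest≢v) , _) , sameDep) unstored (t , mem) =
  holdS-∉-joinS S (Feasible.Q x̄ k) 0 dest≢v (λ orig≡v → ⊥-elim (orig≢v orig≡v))
    unstored sameDep mem
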